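{- Let $d \ge 0$. Assuming $a=i_1-i_2-n_2-n_3$, $i_1+i_2 \equiv n_2+n_3+1 \pmod 2$ and $i_2+n_3+d \ge i_1+n_1$, the $i_1$-th row of the $d$-th difference with respect to the rows in the top block of $M_{n_1,n_2,n_3}$ is equal to the $i_2$-th row of the $d$-th difference with respect to the rows in the bottom block of $M_{n_1,n_2,n_3}$, provided that $1 \le i_1 \le n_2-d$ and $1 \le i_2 \le n_1-d$.
   Context: Let $n_1,n_2,n_3$ be non-negative integers and $a$ a variable. Binomial coefficients are defined by $\binom{n}{k}=\frac{n(n-1)\cdots(n-k+1)}{k!}$ for $k\ge 0$ and $\binom{n}{k}=0$ for $k<0$. Let $M_{n_1,n_2,n_3}$ be the $(n_1+n_2)\times(n_1+n_2)$ block matrix $$ M_{n_1,n_2,n_3} = \left( \begin{array}{c|c} \binom{i-n_1-1}{j-1}_{1 \le i \le n_2, 1 \le j \le n_3} & (-1)^{j+n_3-1} \binom{n_1+n_3+a-i+j-1}{n_1-i}_{1 \le i \le n_2, 1 \le j \le n_1+n_2-n_3} \\ \hline \binom{ -n_1+n_2+n_3+a+i-1}{j-1}_{1 \le i \le n_1, 1 \le j \le n_3} & \binom{ -n_1+n_2+n_3+a+i-1}{ -n_1+n_2+i-j}_{1 \le i \le n_1, 1 \le j \le n_1+n_2-n_3} \end{array} \right), $$ whose determinant (up to sign) counts lozenge tilings of a hexagon with a triangular hole of side $a$ at distances $n_1,n_2,n_3$ from three of its sides. The "top block" consists of the first $n_2$ rows and the "bottom block" of the last $n_1$ rows. With the forward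 difference operator $\Delta_x p(x)=p(x+1)-p(x)$, the $d$-th (forward) difference with respect to the rows of an $m\times n$ matrix $(a_{i,j})$ is the $(m-d)\times n$ matrix $(\Delta_i^d a_{i,j})_{1\le i\le m-d,\,1\le j\le n}$; here it is taken separately within the top block (with $i$ the row index $1\le i\le n_2$ of that block) and within the bottom block (row index $1\le i\le n_1$). -}

module Defs where

open import Data.Nat as ℕ using (ℕ; zero; suc; _!; _≤?_)
open import Data.Nat.Properties using (_!≢0)
open import Data.Integer as ℤ using (ℤ; +_; -[1+_]; _+_; _-_; _*_; -_)
open import Data.Integer.DivMod using (_/ℕ_)
open import Relation.Nullary using (yes; no)

falling : ℤ → ℕ → ℤ
falling n zero    = + 1
falling n (suc k) = falling n k * (n - + k)

-- Generalised binomial coefficient, as in the paper: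
--   binom n k = n (n-1) ... (n-k+1) / k!   for k ≥ 0,   and 0 for k < 0.
-- (The division is exact; _/ℕ_ is integer division.)
binom : ℤ → ℤ → ℤ
binom n (+ k)     = (falling n k /ℕ (k !)) {{k !≢0}}
binom n -[1+ _ ]  = + 0

sgn : ℕ → ℤ
sgn zero    = + 1
sgn (suc e) = - sgn e

-- Entries of M_{n1,n2,n3} with parameter a, 1-based indices as in the paper.
-- Column j (1 ≤ j ≤ n1+n2): left block if j ≤ n3, otherwise right block
-- with local column index j' = j - n3.

-- top block, row i (1 ≤ i ≤ n2)
topEntry : (n₁ n₂ n₃ : ℕ) → ℤ → ℕ → ℕ → ℤ
topEntry n₁ n₂ n₃ a i j with j ≤? n₃
... | yes _ = binom (+ i - + n₁ - + 1) (+ j - + 1)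
... | no  _ = let j' = j ℕ.∸ n₃ in
  sgn (j' ℕ.+ n₃ ℕ.∸ 1) * binom (+ n₁ + + n₃ + a - + i + + j' - + 1) (+ n₁ - + i)

-- bottom block, row i (1 ≤ i ≤ n1)
bottomEntry : (n₁ n₂ n₃ : ℕ) → ℤ → ℕ → ℕ → ℤ
bottomEntry n₁ n₂ n₃ a i j with j ≤? n₃
... | yes _ = binom (- + n₁ + + n₂ + + n₃ + a + + i - + 1) (+ j - + 1)
... | no  _ = let j' = j ℕ.∸ n₃ in
  binom (- + n₁ + + n₂ + + n₃ + a + + i - + 1) (- + n₁ + + n₂ + + i - + j')

Δ^ : ℕ → (ℕ → ℤ) → ℕ → ℤ
Δ^ zero    f i = f i
Δ^ (suc d) f i = Δ^ d f (suc i) - Δ^ d f i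

ΔtopEntry : (n₁ n₂ n₃ : ℕ) → ℤ → ℕ → ℕ → ℕ → ℤ
ΔtopEntry n₁ n₂ n₃ a d i j = Δ^ d (λ r → topEntry n₁ n₂ n₃ a r j) i

ΔbottomEntry : (n₁ n₂ n₃ : ℕ) → ℤ → ℕ → ℕ → ℕ → ℤ
ΔbottomEntry n₁ n₂ n₃ a d i j = Δ^ d (λ r → bottomEntry n₁ n₂ n₃ a r j) i

module Submission where

-- Proof idea.  Write a = i₁ - i₂ - n₂ - n₃ and compare, column by column, the d-th row
-- difference of the top block at row i₁ with that of the bottom block at row i₂.
--
-- * Left block (j ≤ n₃).  Row i₁ + r of the top block and row i₂ + r of the bottom
--   block both equal C(i₁ + r - n₁ - 1, j - 1), so the two difference sequences coincide.
-- * Right block (j = n₃ + k + 1).  Both arguments of the top entry fall by one per row,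
--   both arguments of the bottom entry rise by one, so by Pascal's rule
--     Δ^d top = (-1)^{k+n₃+d} C(V, p)   and   Δ^d bottom = C(U, q),
--   where p + q = M := i₂ + d + n₂ - i₁ - k - 1, and upper negation turns C(V, p) and
--   C(U, q) into ±C(M, p) and ±C(M, q).  The hypothesis i₂ + n₃ + d ≥ i₁ + n₁ together
--   with j ≤ n₁ + n₂ gives M ≥ 0, symmetry of C(M, ·) identifies the two, and the parity hypothesis matches
--   the signs.

open import Defs

module Proof where
  open import Data.Nat as ℕ using (ℕ; zero; suc; _!; _≤_; _<_; _%_; _≤?_; s≤s; z≤n)
  import Data.Nat.Properties as ℕP
  open import Data.Nat.Combinatorics.Base using (_P′_; _P_; _C_)
  open import Data.Nat.Combinatorics using (nCk≡nPk/k!; nCk≡nC[n∸k]; k>n⇒nCk≡0)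
  open import Data.Nat.Combinatorics.Specification using (k!∣nP′k; nP′k≡n!/[n∸k]!; nPk≡n!/[n∸k]!)
  open import Data.Nat.Divisibility using (divides)
  open import Data.Nat.DivMod using (0/n≡0; m≡m%n+[m/n]*n)
  open import Data.Integer as ℤ using (ℤ; +_; -[1+_]; _-_; _+_; _*_; -_; 1ℤ; ∣_∣; _/ℕ_; _%ℕ_)
  import Data.Integer.Properties as ℤP
  open import Algebra.Properties.CommutativeSemigroup ℤP.*-commutativeSemigroup using (x∙yz≈y∙xz)
  open import Data.Integer.DivMod using (a≡a%ℕn+[a/ℕn]*n; n%ℕd<d)
  open import Data.Integer.Tactic.RingSolver using (solve-∀)
  open import Data.Product using (Σ; _,_)
  open import Data.Sum using (_⊎_; inj₁; inj₂)
  open import Data.Empty using (⊥-elim)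
  open import Relation.Nullary using (yes; no)
  import Data.Nat.Tactic.RingSolver as ℕ-Ring
  open import Relation.Binary.PropositionalEquality using (_≡_; refl; sym; trans; cong; cong₂; subst₂; module ≡-Reasoning)
  open ≡-Reasoning

  pos-suc : ∀ n → + suc n ≡ + n + 1ℤ
  pos-suc n = trans (cong +_ (ℕP.+-comm 1 n)) (ℤP.pos-+ n 1)

  -- Integer division by a positive natural inverts multiplication by it:
  -- if x·d = r + q·d with 0 ≤ r < d then (x - q)·d = r forces x = q.
  exact-division : ∀ (x : ℤ) d .{{_ : ℕ.NonZero d}} → (x * + d) /ℕ d ≡ x
  exact-division x d@(suc _) = sym (ℤP.i-j≡0⇒i≡j x q (small-multiple (x - q) remainder))
    where
    q = (x * + d) /ℕ d
    r = (x * + d) %ℕ d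
    remainder : (x - q) * + d ≡ + r
    remainder = begin
      (x - q) * + d          ≡⟨ distrib x q (+ d) ⟩
      x * + d - q * + d      ≡⟨ cong (_- q * + d) (a≡a%ℕn+[a/ℕn]*n (x * + d) d) ⟩
      + r + q * + d - q * + d ≡⟨ cancel (+ r) (q * + d) ⟩
      + r                    ∎
      where
      distrib : ∀ x q d → (x - q) * d ≡ x * d - q * d
      distrib = solve-∀
      cancel : ∀ r y → r + y - y ≡ r
      cancel = solve-∀
    small-multiple : ∀ z → z * + d ≡ + r → z ≡ + 0
    small-multiple (+ zero)  _ = refl
    small-multiple (+ suc m) e = ⊥-elim (ℕP.<⇒≱ (n%ℕd<d (x * + d) d) d≤r)
      where
      d≤r : d ℕ.≤ r
      d≤r = ℕP.≤-trans (ℕP.m≤m+n d (m ℕ.* d))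
                       (ℕP.≤-reflexive (ℤP.+-injective (trans (sym (ℤP.pos-* (suc m) d)) e)))
    small-multiple -[1+ m ] ()

  sgn-+ : ∀ m n → sgn (m ℕ.+ n) ≡ sgn m * sgn n
  sgn-+ zero    n = sym (ℤP.*-identityˡ (sgn n))
  sgn-+ (suc m) n = trans (cong -_ (sgn-+ m n)) (ℤP.neg-distribˡ-* (sgn m) (sgn n))

  sgn-square : ∀ n → sgn n * sgn n ≡ 1ℤ
  sgn-square zero    = refl
  sgn-square (suc n) = trans (negate² (sgn n)) (sgn-square n)
    where
    negate² : ∀ s → - s * - s ≡ s * s
    negate² = solve-∀

  sgn-mod-2 : ∀ n → sgn n ≡ sgn (n % 2)
  sgn-mod-2 n = begin
    sgn n                                   ≡⟨ cong sgn (m≡m%n+[m/n]*n n 2) ⟩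
    sgn (n % 2 ℕ.+ h ℕ.* 2)                 ≡⟨ sgn-+ (n % 2) (h ℕ.* 2) ⟩
    sgn (n % 2) * sgn (h ℕ.* 2)             ≡⟨ cong (λ e → sgn (n % 2) * sgn e) double ⟩
    sgn (n % 2) * sgn (h ℕ.+ h)             ≡⟨ cong (sgn (n % 2) *_) (trans (sgn-+ h h) (sgn-square h)) ⟩
    sgn (n % 2) * 1ℤ                        ≡⟨ ℤP.*-identityʳ (sgn (n % 2)) ⟩
    sgn (n % 2)                             ∎
    where
    h = n ℕ./ 2
    double : h ℕ.* 2 ≡ h ℕ.+ h
    double = trans (ℕP.*-comm h 2) (cong (h ℕ.+_) (ℕP.+-identityʳ h))

  sgn-cong-mod-2 : ∀ m n → m % 2 ≡ n % 2 → sgn m ≡ sgn n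
  sgn-cong-mod-2 m n m≡n = trans (sgn-mod-2 m) (trans (cong sgn m≡n) (sym (sgn-mod-2 n)))

  sgnℤ : ℤ → ℤ
  sgnℤ x = sgn ∣ x ∣

  sgnℤ-suc : ∀ x → sgnℤ (x + 1ℤ) ≡ - sgnℤ x
  sgnℤ-suc (+ n)        = cong sgn (ℕP.+-comm n 1)
  sgnℤ-suc -[1+ zero ]  = refl
  sgnℤ-suc -[1+ suc n ] = sym (ℤP.neg-involutive (sgn (suc n)))

  -- x ↦ (-1)^x is a homomorphism from (ℤ, +) to (ℤ, ·): by induction for y ≥ 0, and for
  -- y = -(n+1) by applying that case to z = x + y and cancelling the sign of n+1.
  sgnℤ-+ : ∀ x y → sgnℤ (x + y) ≡ sgnℤ x * sgnℤ y
  sgnℤ-+ x (+ n) = shift-up n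
    where
    shift-up : ∀ n → sgnℤ (x + + n) ≡ sgnℤ x * sgn n
    shift-up zero    = trans (cong sgnℤ (ℤP.+-identityʳ x)) (sym (ℤP.*-identityʳ (sgnℤ x)))
    shift-up (suc n) = begin
      sgnℤ (x + + suc n)         ≡⟨ cong (λ s → sgnℤ (x + s)) (pos-suc n) ⟩
      sgnℤ (x + (+ n + 1ℤ))      ≡⟨ cong sgnℤ (ℤP.+-assoc x (+ n) 1ℤ) ⟨
      sgnℤ (x + + n + 1ℤ)        ≡⟨ sgnℤ-suc (x + + n) ⟩
      - sgnℤ (x + + n)           ≡⟨ cong -_ (shift-up n) ⟩
      - (sgnℤ x * sgn n)         ≡⟨ ℤP.neg-distribʳ-* (sgnℤ x) (sgn n) ⟩
      sgnℤ x * - sgn n           ∎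
  sgnℤ-+ x -[1+ n ] = begin
    sgnℤ z                                 ≡⟨ ℤP.*-identityʳ (sgnℤ z) ⟨
    sgnℤ z * 1ℤ                            ≡⟨ cong (sgnℤ z *_) (sgn-square (suc n)) ⟨
    sgnℤ z * (sgn (suc n) * sgn (suc n))   ≡⟨ ℤP.*-assoc (sgnℤ z) (sgn (suc n)) (sgn (suc n)) ⟨
    sgnℤ z * sgn (suc n) * sgn (suc n)     ≡⟨ cong (_* sgn (suc n)) (sgnℤ-+ z (+ suc n)) ⟨
    sgnℤ (z + + suc n) * sgn (suc n)       ≡⟨ cong (λ w → sgnℤ w * sgn (suc n)) (cancel x (+ suc n)) ⟩
    sgnℤ x * sgn (suc n)                   ∎
    where
    z = x + -[1+ n ]
    cancel : ∀ x m → x - m + m ≡ x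
    cancel = solve-∀

  sgnℤ-parity : ∀ x y m n w → x + + m ≡ y + + n + (w + w) → sgn m ≡ sgn n → sgnℤ x ≡ sgnℤ y
  sgnℤ-parity x y m n w shift sm≡sn = begin
    sgnℤ x                                ≡⟨ ℤP.*-identityʳ (sgnℤ x) ⟨
    sgnℤ x * 1ℤ                           ≡⟨ cong (sgnℤ x *_) (sgn-square m) ⟨
    sgnℤ x * (sgn m * sgn m)              ≡⟨ ℤP.*-assoc (sgnℤ x) (sgn m) (sgn m) ⟨
    sgnℤ x * sgn m * sgn m                ≡⟨ cong (_* sgn m) (sgnℤ-+ x (+ m)) ⟨
    sgnℤ (x + + m) * sgn m                ≡⟨ cong (λ z → sgnℤ z * sgn m) shift ⟩
    sgnℤ (y + + n + (w + w)) * sgn m      ≡⟨ cong (_* sgn m) (sgnℤ-+ (y + + n) (w + w)) ⟩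
    sgnℤ (y + + n) * sgnℤ (w + w) * sgn m ≡⟨ cong (λ s → sgnℤ (y + + n) * s * sgn m) even ⟩
    sgnℤ (y + + n) * 1ℤ * sgn m           ≡⟨ cong₂ (λ s t → s * 1ℤ * t) (sgnℤ-+ y (+ n)) sm≡sn ⟩
    sgnℤ y * sgn n * 1ℤ * sgn n           ≡⟨ regroup (sgnℤ y) (sgn n) ⟩
    sgnℤ y * (sgn n * sgn n)              ≡⟨ cong (sgnℤ y *_) (sgn-square n) ⟩
    sgnℤ y * 1ℤ                           ≡⟨ ℤP.*-identityʳ (sgnℤ y) ⟩
    sgnℤ y                                ∎
    where
    even : sgnℤ (w + w) ≡ 1ℤ
    even = trans (sgnℤ-+ w w) (sgn-square ∣ w ∣)
    regroup : ∀ a s → a * s * + 1 * s ≡ a * (s * s)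
    regroup = solve-∀

  falling-succ : ∀ x k → falling (x + 1ℤ) (suc k) ≡ (x + 1ℤ) * falling x k
  falling-succ x zero = base x
    where
    base : ∀ x → + 1 * (x + + 1 - + 0) ≡ (x + + 1) * + 1
    base = solve-∀
  falling-succ x (suc k) = begin
    falling (x + 1ℤ) (suc k) * (x + 1ℤ - + suc k)
      ≡⟨ cong₂ (λ f s → f * (x + 1ℤ - s)) (falling-succ x k) (ℤP.pos-+ 1 k) ⟩
    (x + 1ℤ) * falling x k * (x + 1ℤ - (1ℤ + + k))
      ≡⟨ regroup x (falling x k) (+ k) ⟩
    (x + 1ℤ) * (falling x k * (x - + k)) ∎
    where
    regroup : ∀ x f k → (x + + 1) * f * (x + + 1 - (+ 1 + k)) ≡ (x + + 1) * (f * (x - k))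
    regroup = solve-∀

  falling-pascal : ∀ x k → falling (x + 1ℤ) (suc k) ≡ falling x (suc k) + + suc k * falling x k
  falling-pascal x k = begin
    falling (x + 1ℤ) (suc k)                           ≡⟨ falling-succ x k ⟩
    (x + 1ℤ) * falling x k                             ≡⟨ split x (falling x k) (+ k) ⟩
    falling x k * (x - + k) + (1ℤ + + k) * falling x k ≡⟨ cong (λ s → falling x (suc k) + s * falling x k) (ℤP.pos-+ 1 k) ⟨
    falling x (suc k) + + suc k * falling x k          ∎
    where
    split : ∀ x f k → (x + + 1) * f ≡ f * (x - k) + (+ 1 + k) * f
    split = solve-∀

  falling-negate : ∀ x k → falling x k ≡ sgn k * falling (+ k - x - 1ℤ) k
  falling-negate x zero = refl
  falling-negate x (suc k) = begin
    falling x k * (x - + k)                   ≡⟨ cong (_* (x - + k)) (falling-negate x k) ⟩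
    sgn k * falling y k * (x - + k)           ≡⟨ regroup (sgn k) (falling y k) x (+ k) ⟩
    - sgn k * ((y + 1ℤ) * falling y k)        ≡⟨ cong (- sgn k *_) (falling-succ y k) ⟨
    - sgn k * falling (y + 1ℤ) (suc k)        ≡⟨ cong (λ z → - sgn k * falling z (suc k)) shift ⟩
    - sgn k * falling (+ suc k - x - 1ℤ) (suc k) ∎
    where
    y = + k - x - 1ℤ
    regroup : ∀ s f x k → s * f * (x - k) ≡ - s * ((k - x - + 1 + + 1) * f)
    regroup = solve-∀
    reorder : ∀ k x → k - x - + 1 + + 1 ≡ k + + 1 - x - + 1
    reorder = solve-∀
    shift : y + 1ℤ ≡ + suc k - x - 1ℤ
    shift = trans (reorder (+ k) x) (cong (λ z → z - x - 1ℤ) (sym (pos-suc k)))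

  falling-nat : ∀ {n k} → k ≤ n → falling (+ n) k ≡ + (n P′ k)
  falling-nat {n} {zero}  _   = refl
  falling-nat {n} {suc k} k<n = begin
    falling (+ n) k * (+ n - + k)   ≡⟨ cong₂ _*_ (falling-nat (ℕP.<⇒≤ k<n)) n-k ⟩
    + (n P′ k) * + (n ℕ.∸ k)        ≡⟨ ℤP.pos-* (n P′ k) (n ℕ.∸ k) ⟨
    + ((n P′ k) ℕ.* (n ℕ.∸ k))      ≡⟨ cong +_ (ℕP.*-comm (n P′ k) (n ℕ.∸ k)) ⟩
    + ((n ℕ.∸ k) ℕ.* (n P′ k))      ∎
    where
    n-k : + n - + k ≡ + (n ℕ.∸ k)
    n-k = trans (ℤP.m-n≡m⊖n n k) (ℤP.⊖-≥ (ℕP.<⇒≤ k<n))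

  -- A natural upper argument n < k contributes the factor n - n = 0.
  falling-vanish : ∀ {n k} → n < k → falling (+ n) k ≡ + 0
  falling-vanish {n} {suc k} (s≤s n≤k) with ℕP.m≤n⇒m<n∨m≡n n≤k
  ... | inj₁ n<k = trans (cong (_* (+ n - + k)) (falling-vanish n<k)) (ℤP.*-zeroˡ (+ n - + k))
  ... | inj₂ refl = trans (cong (falling (+ n) n *_) (ℤP.i≡j⇒i-j≡0 {+ n} refl)) (ℤP.*-zeroʳ (falling (+ n) n))

  -- k! divides the falling factorial x^{(k)} for every integer x: for x = n ≥ k this is
  -- the divisibility k! ∣ nPk, for 0 ≤ n < k the falling factorial vanishes, and a
  -- negative x is reduced to a natural upper argument by upper negation.
  factorial-divides-falling : ∀ x k → Σ ℤ λ A → + (k !) * A ≡ falling x k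
  factorial-divides-falling (+ n) k with k ≤? n
  ... | yes k≤n with k!∣nP′k k≤n
  ...   | divides q nPk≡q*k! = + q , (begin
    + (k !) * + q       ≡⟨ ℤP.pos-* (k !) q ⟨
    + (k ! ℕ.* q)       ≡⟨ cong +_ (trans (ℕP.*-comm (k !) q) (sym nPk≡q*k!)) ⟩
    + (n P′ k)          ≡⟨ falling-nat k≤n ⟨
    falling (+ n) k     ∎)
  factorial-divides-falling (+ n) k | no k≰n =
    + 0 , trans (ℤP.*-zeroʳ (+ (k !))) (sym (falling-vanish (ℕP.≰⇒> k≰n)))
  factorial-divides-falling x@(-[1+ m ]) k with factorial-divides-falling (+ (k ℕ.+ m)) k
  ... | A , k!A≡falling = sgn k * A , (begin
    + (k !) * (sgn k * A)            ≡⟨ x∙yz≈y∙xz (+ (k !)) (sgn k) A ⟩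
    sgn k * (+ (k !) * A)            ≡⟨ cong (sgn k *_) k!A≡falling ⟩
    sgn k * falling (+ (k ℕ.+ m)) k  ≡⟨ cong (λ y → sgn k * falling y k) negated ⟨
    sgn k * falling (+ k - x - 1ℤ) k ≡⟨ falling-negate x k ⟨
    falling x k                      ∎)
    where
    shift : ∀ k m → k + (m + + 1) - + 1 ≡ k + m
    shift = solve-∀
    negated : + k - x - 1ℤ ≡ + (k ℕ.+ m)
    negated = trans (cong (λ s → + k + s - 1ℤ) (pos-suc m)) (trans (shift (+ k) (+ m)) (sym (ℤP.pos-+ k m)))

  binom-unique : ∀ x k A → + (k !) * A ≡ falling x k → binom x (+ k) ≡ A
  binom-unique x k A k!A≡falling = begin
    (falling x k /ℕ k !) {{k ℕP.!≢0}}   ≡⟨ cong (λ y → (y /ℕ k !) {{k ℕP.!≢0}}) (trans (sym k!A≡falling) (ℤP.*-comm (+ (k !)) A)) ⟩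
    ((A * + (k !)) /ℕ k !) {{k ℕP.!≢0}} ≡⟨ exact-division A (k !) {{k ℕP.!≢0}} ⟩
    A                                  ∎

  binom-spec : ∀ x k → + (k !) * binom x (+ k) ≡ falling x k
  binom-spec x k with factorial-divides-falling x k
  ... | A , k!A≡falling rewrite binom-unique x k A k!A≡falling = k!A≡falling

  binom-pascal : ∀ x m → binom (x + 1ℤ) (m + 1ℤ) ≡ binom x m + binom x (m + 1ℤ)
  binom-pascal x (+ k) rewrite ℕP.+-comm k 1 = binom-unique (x + 1ℤ) (suc k) _ (begin
    + (suc k !) * (b₀ + b₁)                         ≡⟨ cong (_* (b₀ + b₁)) (ℤP.pos-* (suc k) (k !)) ⟩
    + suc k * + (k !) * (b₀ + b₁)                   ≡⟨ expand (+ suc k) (+ (k !)) b₀ b₁ ⟩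
    + suc k * + (k !) * b₁ + + suc k * (+ (k !) * b₀)
      ≡⟨ cong₂ _+_ (trans (cong (_* b₁) (sym (ℤP.pos-* (suc k) (k !)))) (binom-spec x (suc k)))
                   (cong (+ suc k *_) (binom-spec x k)) ⟩
    falling x (suc k) + + suc k * falling x k       ≡⟨ falling-pascal x k ⟨
    falling (x + 1ℤ) (suc k)                        ∎)
    where
    b₀ = binom x (+ k)
    b₁ = binom x (+ suc k)
    expand : ∀ s f a b → s * f * (a + b) ≡ s * f * b + s * (f * a)
    expand = solve-∀
  binom-pascal x -[1+ zero ]  = refl
  binom-pascal x -[1+ suc n ] = refl

  binom-negate : ∀ x p → binom x p ≡ sgnℤ p * binom (p - x - 1ℤ) p
  binom-negate x (+ k) = binom-unique x k _ (begin
    + (k !) * (sgn k * binom y (+ k)) ≡⟨ x∙yz≈y∙xz (+ (k !)) (sgn k) (binom y (+ k)) ⟩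
    sgn k * (+ (k !) * binom y (+ k)) ≡⟨ cong (sgn k *_) (binom-spec y k) ⟩
    sgn k * falling y k               ≡⟨ falling-negate x k ⟨
    falling x k                       ∎)
    where
    y = + k - x - 1ℤ
  binom-negate x -[1+ n ] = sym (ℤP.*-zeroʳ (sgn (suc n)))

  binom-nat : ∀ n k → binom (+ n) (+ k) ≡ + (n C k)
  binom-nat n k with k ≤? n
  ... | yes k≤n = begin
    (falling (+ n) k /ℕ k !) {{k ℕP.!≢0}}  ≡⟨ cong (λ y → (y /ℕ k !) {{k ℕP.!≢0}}) (falling-nat k≤n) ⟩
    + (((n P′ k) ℕ./ k !) {{k ℕP.!≢0}})    ≡⟨ cong (λ y → + ((y ℕ./ k !) {{k ℕP.!≢0}})) P′≡P ⟩
    + (((n P k) ℕ./ k !) {{k ℕP.!≢0}})     ≡⟨ cong +_ (nCk≡nPk/k! k≤n) ⟨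
    + (n C k)                              ∎
    where
    P′≡P : n P′ k ≡ n P k
    P′≡P = trans (nP′k≡n!/[n∸k]! k≤n) (sym (nPk≡n!/[n∸k]! k≤n))
  ... | no k≰n = begin
    (falling (+ n) k /ℕ k !) {{k ℕP.!≢0}}  ≡⟨ cong (λ y → (y /ℕ k !) {{k ℕP.!≢0}}) (falling-vanish (ℕP.≰⇒> k≰n)) ⟩
    + ((0 ℕ./ k !) {{k ℕP.!≢0}})           ≡⟨ cong +_ (0/n≡0 (k !) {{k ℕP.!≢0}}) ⟩
    + 0                                    ≡⟨ cong +_ (k>n⇒nCk≡0 (ℕP.≰⇒> k≰n)) ⟨
    + (n C k)                              ∎

  -- If p < 0 and p + q = M ≥ 0, then q > M and C(M, q) vanishes.
  binom-beyond : ∀ M n q → -[1+ n ] + q ≡ + M → binom (+ M) q ≡ + 0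
  binom-beyond M n q p+q≡M = begin
    binom (+ M) q                 ≡⟨ cong (binom (+ M)) q≡M+n+1 ⟩
    binom (+ M) (+ (M ℕ.+ suc n)) ≡⟨ binom-nat M (M ℕ.+ suc n) ⟩
    + (M C (M ℕ.+ suc n))         ≡⟨ cong +_ (k>n⇒nCk≡0 (ℕP.m<m+n M (s≤s z≤n))) ⟩
    + 0                           ∎
    where
    solve-for : ∀ q m → q ≡ - m + q + m
    solve-for = solve-∀
    q≡M+n+1 : q ≡ + (M ℕ.+ suc n)
    q≡M+n+1 = trans (solve-for q (+ suc n)) (cong (_+ + suc n) p+q≡M)

  -- Symmetry  C(M, p) = C(M, q)  whenever p + q = M ≥ 0, for all integers p and q
  -- (if one of them is negative both sides vanish).
  binom-symmetric : ∀ M p q → p + q ≡ + M → binom (+ M) p ≡ binom (+ M) q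
  binom-symmetric .(k ℕ.+ l) (+ k) (+ l) refl = begin
    binom (+ M) (+ k)   ≡⟨ binom-nat M k ⟩
    + (M C k)           ≡⟨ cong +_ (nCk≡nC[n∸k] (ℕP.m≤m+n k l)) ⟩
    + (M C (M ℕ.∸ k))   ≡⟨ cong (λ i → + (M C i)) (ℕP.m+n∸m≡n k l) ⟩
    + (M C l)           ≡⟨ binom-nat M l ⟨
    binom (+ M) (+ l)   ∎
    where
    M = k ℕ.+ l
  binom-symmetric M -[1+ n ] q p+q≡M = sym (binom-beyond M n q p+q≡M)
  binom-symmetric M p@(+ _) -[1+ n ] p+q≡M =
    binom-beyond M n p (trans (ℤP.+-comm -[1+ n ] p) p+q≡M)

  -- Reflection: if C(v, p) and C(u, q) are both upper negations of the two halves
  -- C(M, p) = C(M, q) of one symmetric pair (p + q = M), they agree up to the signs.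
  binom-reflection : ∀ M (σ v p u q : ℤ) → p + q ≡ + M → p - v - 1ℤ ≡ + M → q - u - 1ℤ ≡ + M →
                     σ * sgnℤ p ≡ sgnℤ q → σ * binom v p ≡ binom u q
  binom-reflection M σ v p u q p+q≡M p-v-1≡M q-u-1≡M signs = begin
    σ * binom v p                        ≡⟨ cong (σ *_) (binom-negate v p) ⟩
    σ * (sgnℤ p * binom (p - v - 1ℤ) p)  ≡⟨ ℤP.*-assoc σ (sgnℤ p) _ ⟨
    σ * sgnℤ p * binom (p - v - 1ℤ) p    ≡⟨ cong₂ (λ s y → s * binom y p) signs p-v-1≡M ⟩
    sgnℤ q * binom (+ M) p               ≡⟨ cong (sgnℤ q *_) (binom-symmetric M p q p+q≡M) ⟩
    sgnℤ q * binom (+ M) q               ≡⟨ cong (λ y → sgnℤ q * binom y q) q-u-1≡M ⟨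
    sgnℤ q * binom (q - u - 1ℤ) q        ≡⟨ binom-negate u q ⟨
    binom u q                            ∎

  Δ-translate : ∀ d (f g : ℕ → ℤ) i₁ i₂ → (∀ r → f (i₁ ℕ.+ r) ≡ g (i₂ ℕ.+ r)) → Δ^ d f i₁ ≡ Δ^ d g i₂
  Δ-translate zero    f g i₁ i₂ agree =
    subst₂ (λ s t → f s ≡ g t) (ℕP.+-identityʳ i₁) (ℕP.+-identityʳ i₂) (agree 0)
  Δ-translate (suc d) f g i₁ i₂ agree =
    cong₂ _-_ (Δ-translate d f g (suc i₁) (suc i₂) agree-from-next) (Δ-translate d f g i₁ i₂ agree)
    where
    agree-from-next : ∀ r → f (suc i₁ ℕ.+ r) ≡ g (suc i₂ ℕ.+ r)
    agree-from-next r = subst₂ (λ s t → f s ≡ g t) (ℕP.+-suc i₁ r) (ℕP.+-suc i₂ r) (agree (suc r))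

  Δ-cong : ∀ d (f g : ℕ → ℤ) i → (∀ r → f r ≡ g r) → Δ^ d f i ≡ Δ^ d g i
  Δ-cong d f g i f≗g = Δ-translate d f g i i (λ r → f≗g (i ℕ.+ r))

  Δ-scale : ∀ d c (f : ℕ → ℤ) i → Δ^ d (λ r → c * f r) i ≡ c * Δ^ d f i
  Δ-scale zero    c f i = refl
  Δ-scale (suc d) c f i =
    trans (cong₂ _-_ (Δ-scale d c f (suc i)) (Δ-scale d c f i)) (factor c (Δ^ d f (suc i)) (Δ^ d f i))
    where
    factor : ∀ c a b → c * a - c * b ≡ c * (a - b)
    factor = solve-∀

  -- Both arguments rising with the row:  Δ^d C(x+r, y+r) = C(x+r, y+r+d),
  -- one application of Pascal's rule per difference.
  Δ-ascending : ∀ d x y i → Δ^ d (λ r → binom (x + + r) (y + + r)) i ≡ binom (x + + i) (y + + i + + d)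
  Δ-ascending zero    x y i = cong (binom (x + + i)) (sym (ℤP.+-identityʳ (y + + i)))
  Δ-ascending (suc d) x y i = begin
    Δ^ d F (suc i) - Δ^ d F i                            ≡⟨ cong₂ _-_ (Δ-ascending d x y (suc i)) (Δ-ascending d x y i) ⟩
    binom (x + + suc i) (y + + suc i + + d) - binom X K  ≡⟨ cong₂ (λ s t → binom s t - binom X K) upper lower ⟩
    binom (X + 1ℤ) (K + 1ℤ) - binom X K                  ≡⟨ cong (_- binom X K) (binom-pascal X K) ⟩
    binom X K + binom X (K + 1ℤ) - binom X K             ≡⟨ cancel (binom X K) (binom X (K + 1ℤ)) ⟩
    binom X (K + 1ℤ)                                     ≡⟨ cong (binom X) lower-end ⟩
    binom X (y + + i + + suc d)                          ∎
    where
    F = λ r → binom (x + + r) (y + + r)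
    X = x + + i
    K = y + + i + + d
    cancel : ∀ a b → a + b - a ≡ b
    cancel = solve-∀
    shift₁ : ∀ x i → x + (i + + 1) ≡ x + i + + 1
    shift₁ = solve-∀
    shift₂ : ∀ y i d → y + (i + + 1) + d ≡ y + i + d + + 1
    shift₂ = solve-∀
    upper : x + + suc i ≡ X + 1ℤ
    upper = trans (cong (λ t → x + t) (pos-suc i)) (shift₁ x (+ i))
    lower : y + + suc i + + d ≡ K + 1ℤ
    lower = trans (cong (λ s → y + s + + d) (pos-suc i)) (shift₂ y (+ i) (+ d))
    lower-end : K + 1ℤ ≡ y + + i + + suc d
    lower-end = trans (ℤP.+-assoc (y + + i) (+ d) 1ℤ) (cong (λ t → y + + i + t) (sym (pos-suc d)))

  Δ-descending : ∀ d x y i → Δ^ d (λ r → binom (x - + r) (y - + r)) i ≡ sgn d * binom (x - + i - + d) (y - + i)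
  Δ-descending zero    x y i =
    trans (cong (λ s → binom s (y - + i)) (sym (ℤP.+-identityʳ (x - + i)))) (sym (ℤP.*-identityˡ _))
  Δ-descending (suc d) x y i = begin
    Δ^ d F (suc i) - Δ^ d F i
      ≡⟨ cong₂ _-_ (Δ-descending d x y (suc i)) (Δ-descending d x y i) ⟩
    s * binom (x - + suc i - + d) (y - + suc i) - s * binom (x - + i - + d) (y - + i)
      ≡⟨ cong₂ (λ a b → s * binom a b - s * binom (x - + i - + d) (y - + i)) upper lower ⟩
    s * binom X Y - s * binom (x - + i - + d) (y - + i)
      ≡⟨ cong₂ (λ a b → s * binom X Y - s * binom a b) upper′ lower′ ⟩
    s * binom X Y - s * binom (X + 1ℤ) (Y + 1ℤ)
      ≡⟨ cong (λ b → s * binom X Y - s * b) (binom-pascal X Y) ⟩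
    s * binom X Y - s * (binom X Y + binom X (Y + 1ℤ))
      ≡⟨ cancel s (binom X Y) (binom X (Y + 1ℤ)) ⟩
    - s * binom X (Y + 1ℤ)
      ≡⟨ cong (λ b → - s * binom X b) lower′ ⟨
    - s * binom X (y - + i)
      ∎
    where
    F = λ r → binom (x - + r) (y - + r)
    s = sgn d
    X = x - + i - + suc d
    Y = y - + i - 1ℤ
    cancel : ∀ s a b → s * a - s * (a + b) ≡ - s * b
    cancel = solve-∀
    shift₁ : ∀ x i d → x - (i + + 1) - d ≡ x - i - (d + + 1)
    shift₁ = solve-∀
    shift₂ : ∀ y i → y - (i + + 1) ≡ y - i - + 1
    shift₂ = solve-∀
    shift₃ : ∀ x i d → x - i - d ≡ x - i - (d + + 1) + + 1
    shift₃ = solve-∀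
    shift₄ : ∀ y i → y - i ≡ y - i - + 1 + + 1
    shift₄ = solve-∀
    upper : x - + suc i - + d ≡ X
    upper = trans (cong (λ t → x - t - + d) (pos-suc i))
                  (trans (shift₁ x (+ i) (+ d)) (cong (λ t → x - + i - t) (sym (pos-suc d))))
    lower : y - + suc i ≡ Y
    lower = trans (cong (λ t → y - t) (pos-suc i)) (shift₂ y (+ i))
    upper′ : x - + i - + d ≡ X + 1ℤ
    upper′ = trans (shift₃ x (+ i) (+ d)) (cong (λ t → x - + i - t + 1ℤ) (sym (pos-suc d)))
    lower′ : y - + i ≡ Y + 1ℤ
    lower′ = shift₄ y (+ i)

  -- The size of the triangular hole for which the two rows are compared.
  matching-a : (i₁ i₂ n₂ n₃ : ℕ) → ℤ
  matching-a i₁ i₂ n₂ n₃ = + i₁ - + i₂ - + n₂ - + n₃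

  topEntry-left : ∀ n₁ n₂ n₃ a r j → j ≤ n₃ → topEntry n₁ n₂ n₃ a r j ≡ binom (+ r - + n₁ - + 1) (+ j - + 1)
  topEntry-left n₁ n₂ n₃ a r j j≤n₃ with j ≤? n₃
  ... | yes _   = refl
  ... | no j≰n₃ = ⊥-elim (j≰n₃ j≤n₃)

  bottomEntry-left : ∀ n₁ n₂ n₃ a r j → j ≤ n₃ →
                     bottomEntry n₁ n₂ n₃ a r j ≡ binom (- + n₁ + + n₂ + + n₃ + a + + r - + 1) (+ j - + 1)
  bottomEntry-left n₁ n₂ n₃ a r j j≤n₃ with j ≤? n₃
  ... | yes _   = refl
  ... | no j≰n₃ = ⊥-elim (j≰n₃ j≤n₃)

  topEntry-right : ∀ n₁ n₂ n₃ a r k → topEntry n₁ n₂ n₃ a r (n₃ ℕ.+ suc k) ≡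
                   sgn (k ℕ.+ n₃) * binom (+ n₁ + + n₃ + a - + r + + suc k - + 1) (+ n₁ - + r)
  topEntry-right n₁ n₂ n₃ a r k with n₃ ℕ.+ suc k ≤? n₃
  ... | yes j≤n₃ = ⊥-elim (ℕP.m+1+n≰m n₃ j≤n₃)
  ... | no _ rewrite ℕP.m+n∸m≡n n₃ (suc k) = refl

  bottomEntry-right : ∀ n₁ n₂ n₃ a r k → bottomEntry n₁ n₂ n₃ a r (n₃ ℕ.+ suc k) ≡
                      binom (- + n₁ + + n₂ + + n₃ + a + + r - + 1) (- + n₁ + + n₂ + + r - + suc k)
  bottomEntry-right n₁ n₂ n₃ a r k with n₃ ℕ.+ suc k ≤? n₃
  ... | yes j≤n₃ = ⊥-elim (ℕP.m+1+n≰m n₃ j≤n₃)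
  ... | no _ rewrite ℕP.m+n∸m≡n n₃ (suc k) = refl

  column-split : ∀ n₃ j → j ≤ n₃ ⊎ Σ ℕ (λ k → j ≡ n₃ ℕ.+ suc k)
  column-split n₃ j with j ≤? n₃
  ... | yes j≤n₃ = inj₁ j≤n₃
  ... | no j≰n₃ with ℕP.m≤n⇒∃[o]m+o≡n (ℕP.≰⇒> j≰n₃)
  ...   | k , n₃+1+k≡j = inj₂ (k , sym (trans (ℕP.+-suc n₃ k) n₃+1+k≡j))

  -- Left block: with a = i₁ - i₂ - n₂ - n₃ the top block, read from row i₁, and the
  -- bottom block, read from row i₂, are the same column  C(i₁ + r - n₁ - 1, j - 1).
  left-columns-agree : ∀ n₁ n₂ n₃ d i₁ i₂ j → j ≤ n₃ → let a = matching-a i₁ i₂ n₂ n₃ in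
                       ΔtopEntry n₁ n₂ n₃ a d i₁ j ≡ ΔbottomEntry n₁ n₂ n₃ a d i₂ j
  left-columns-agree n₁ n₂ n₃ d i₁ i₂ j j≤n₃ = Δ-translate d _ _ i₁ i₂ same-rows
    where
    a = matching-a i₁ i₂ n₂ n₃
    align : ∀ i₁ i₂ n₁ n₂ n₃ r → i₁ + r - n₁ - + 1 ≡ - n₁ + n₂ + n₃ + (i₁ - i₂ - n₂ - n₃) + (i₂ + r) - + 1
    align = solve-∀
    same-rows : ∀ r → topEntry n₁ n₂ n₃ a (i₁ ℕ.+ r) j ≡ bottomEntry n₁ n₂ n₃ a (i₂ ℕ.+ r) j
    same-rows r = begin
      topEntry n₁ n₂ n₃ a (i₁ ℕ.+ r) j
        ≡⟨ topEntry-left n₁ n₂ n₃ a (i₁ ℕ.+ r) j j≤n₃ ⟩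
      binom (+ (i₁ ℕ.+ r) - + n₁ - + 1) (+ j - + 1)
        ≡⟨ cong (λ s → binom (s - + n₁ - + 1) (+ j - + 1)) (ℤP.pos-+ i₁ r) ⟩
      binom (+ i₁ + + r - + n₁ - + 1) (+ j - + 1)
        ≡⟨ cong (λ s → binom s (+ j - + 1)) (align (+ i₁) (+ i₂) (+ n₁) (+ n₂) (+ n₃) (+ r)) ⟩
      binom (- + n₁ + + n₂ + + n₃ + a + (+ i₂ + + r) - + 1) (+ j - + 1)
        ≡⟨ cong (λ s → binom (- + n₁ + + n₂ + + n₃ + a + s - + 1) (+ j - + 1)) (ℤP.pos-+ i₂ r) ⟨
      binom (- + n₁ + + n₂ + + n₃ + a + + (i₂ ℕ.+ r) - + 1) (+ j - + 1)
        ≡⟨ bottomEntry-left n₁ n₂ n₃ a (i₂ ℕ.+ r) j j≤n₃ ⟨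
      bottomEntry n₁ n₂ n₃ a (i₂ ℕ.+ r) j
        ∎

  right-column-signs : ∀ n₁ n₂ n₃ d i₁ i₂ k → sgn (i₁ ℕ.+ i₂) ≡ sgn (n₂ ℕ.+ n₃ ℕ.+ 1) →
                       sgn (k ℕ.+ n₃) * sgn d * sgnℤ (+ n₁ - + i₁) ≡ sgnℤ (- + n₁ + + n₂ - + suc k + + i₂ + + d)
  right-column-signs n₁ n₂ n₃ d i₁ i₂ k parity = begin
    sgnℤ (+ (k ℕ.+ n₃)) * sgnℤ (+ d) * sgnℤ p  ≡⟨ cong (_* sgnℤ p) (sgnℤ-+ (+ (k ℕ.+ n₃)) (+ d)) ⟨
    sgnℤ (+ (k ℕ.+ n₃) + + d) * sgnℤ p         ≡⟨ sgnℤ-+ (+ (k ℕ.+ n₃) + + d) p ⟨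
    sgnℤ (+ (k ℕ.+ n₃) + + d + p)              ≡⟨ sgnℤ-parity (+ (k ℕ.+ n₃) + + d + p) q (i₁ ℕ.+ i₂) (n₂ ℕ.+ n₃ ℕ.+ 1) w shift parity ⟩
    sgnℤ q                                     ∎
    where
    p = + n₁ - + i₁
    q = - + n₁ + + n₂ - + suc k + + i₂ + + d
    w = + k + + n₁ - + n₂
    balance : ∀ k n₁ n₂ n₃ d i₁ i₂ →
              k + n₃ + d + (n₁ - i₁) + (i₁ + i₂) ≡
              - n₁ + n₂ - (k + + 1) + i₂ + d + (n₂ + n₃ + + 1) + ((k + n₁ - n₂) + (k + n₁ - n₂))
    balance = solve-∀
    shift : + (k ℕ.+ n₃) + + d + p + + (i₁ ℕ.+ i₂) ≡ q + + (n₂ ℕ.+ n₃ ℕ.+ 1) + (w + w)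
    shift = begin
      + (k ℕ.+ n₃) + + d + p + + (i₁ ℕ.+ i₂)
        ≡⟨ cong₂ (λ s t → s + + d + p + t) (ℤP.pos-+ k n₃) (ℤP.pos-+ i₁ i₂) ⟩
      + k + + n₃ + + d + p + (+ i₁ + + i₂)
        ≡⟨ balance (+ k) (+ n₁) (+ n₂) (+ n₃) (+ d) (+ i₁) (+ i₂) ⟩
      - + n₁ + + n₂ - (+ k + + 1) + + i₂ + + d + (+ n₂ + + n₃ + + 1) + (w + w)
        ≡⟨ cong₂ (λ s t → - + n₁ + + n₂ - s + + i₂ + + d + t + (w + w)) (pos-suc k) n₂+n₃+1 ⟨
      q + + (n₂ ℕ.+ n₃ ℕ.+ 1) + (w + w)
        ∎
      where
      n₂+n₃+1 : + (n₂ ℕ.+ n₃ ℕ.+ 1) ≡ + n₂ + + n₃ + + 1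
      n₂+n₃+1 = trans (ℤP.pos-+ (n₂ ℕ.+ n₃) 1) (cong (_+ + 1) (ℤP.pos-+ n₂ n₃))

  column-room : ∀ n₁ n₂ n₃ d i₁ i₂ k → i₁ ℕ.+ n₁ ≤ i₂ ℕ.+ n₃ ℕ.+ d → n₃ ℕ.+ suc k ≤ n₁ ℕ.+ n₂ →
                i₁ ℕ.+ suc k ≤ i₂ ℕ.+ d ℕ.+ n₂
  column-room n₁ n₂ n₃ d i₁ i₂ k rows cols =
    ℕP.+-cancelʳ-≤ (n₁ ℕ.+ n₃) _ _ (subst₂ _≤_ (left i₁ n₁ n₃ (suc k)) (right i₂ n₃ d n₁ n₂) (ℕP.+-mono-≤ rows cols))
    where
    left : ∀ i₁ n₁ n₃ j → i₁ ℕ.+ n₁ ℕ.+ (n₃ ℕ.+ j) ≡ i₁ ℕ.+ j ℕ.+ (n₁ ℕ.+ n₃)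
    left = ℕ-Ring.solve-∀
    right : ∀ i₂ n₃ d n₁ n₂ → i₂ ℕ.+ n₃ ℕ.+ d ℕ.+ (n₁ ℕ.+ n₂) ≡ i₂ ℕ.+ d ℕ.+ n₂ ℕ.+ (n₁ ℕ.+ n₃)
    right = ℕ-Ring.solve-∀

  top-right-difference : ∀ n₁ n₂ n₃ a d i k → let x = + n₁ + + n₃ + a + + suc k - + 1 in
                         ΔtopEntry n₁ n₂ n₃ a d i (n₃ ℕ.+ suc k) ≡
                         sgn (k ℕ.+ n₃) * sgn d * binom (x - + i - + d) (+ n₁ - + i)
  top-right-difference n₁ n₂ n₃ a d i k = begin
    ΔtopEntry n₁ n₂ n₃ a d i (n₃ ℕ.+ suc k)
      ≡⟨ Δ-cong d _ _ i (λ r → trans (topEntry-right n₁ n₂ n₃ a r k)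
                                     (cong (λ s → sgn (k ℕ.+ n₃) * binom s (+ n₁ - + r)) (reorder (+ r)))) ⟩
    Δ^ d (λ r → sgn (k ℕ.+ n₃) * binom (x - + r) (+ n₁ - + r)) i
      ≡⟨ Δ-scale d (sgn (k ℕ.+ n₃)) _ i ⟩
    sgn (k ℕ.+ n₃) * Δ^ d (λ r → binom (x - + r) (+ n₁ - + r)) i
      ≡⟨ cong (sgn (k ℕ.+ n₃) *_) (Δ-descending d x (+ n₁) i) ⟩
    sgn (k ℕ.+ n₃) * (sgn d * binom (x - + i - + d) (+ n₁ - + i))
      ≡⟨ ℤP.*-assoc (sgn (k ℕ.+ n₃)) (sgn d) _ ⟨
    sgn (k ℕ.+ n₃) * sgn d * binom (x - + i - + d) (+ n₁ - + i)
      ∎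
    where
    x = + n₁ + + n₃ + a + + suc k - + 1
    move : ∀ c r s → c - r + s - + 1 ≡ c + s - + 1 - r
    move = solve-∀
    reorder : ∀ r → + n₁ + + n₃ + a - r + + suc k - + 1 ≡ x - r
    reorder r = move (+ n₁ + + n₃ + a) r (+ suc k)

  bottom-right-difference : ∀ n₁ n₂ n₃ a d i k →
                            let u = - + n₁ + + n₂ + + n₃ + a - + 1 ; v = - + n₁ + + n₂ - + suc k in
                            ΔbottomEntry n₁ n₂ n₃ a d i (n₃ ℕ.+ suc k) ≡ binom (u + + i) (v + + i + + d)
  bottom-right-difference n₁ n₂ n₃ a d i k = begin
    ΔbottomEntry n₁ n₂ n₃ a d i (n₃ ℕ.+ suc k)
      ≡⟨ Δ-cong d _ _ i (λ r → trans (bottomEntry-right n₁ n₂ n₃ a r k)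
                                     (cong₂ binom (move-upper (- + n₁ + + n₂ + + n₃ + a) (+ r))
                                                  (move-lower (- + n₁ + + n₂) (+ r) (+ suc k)))) ⟩
    Δ^ d (λ r → binom (u + + r) (v + + r)) i
      ≡⟨ Δ-ascending d u v i ⟩
    binom (u + + i) (v + + i + + d)
      ∎
    where
    u = - + n₁ + + n₂ + + n₃ + a - + 1
    v = - + n₁ + + n₂ - + suc k
    move-upper : ∀ c r → c + r - + 1 ≡ c - + 1 + r
    move-upper = solve-∀
    move-lower : ∀ c r s → c + r - s ≡ c - s + r
    move-lower = solve-∀

  -- Right block: with a = i₁ - i₂ - n₂ - n₃ and M = i₂ + d + n₂ - i₁ - k - 1 ≥ 0, the two
  -- differences above are reflections of the same C(M, ·), with matching signs.
  right-columns-agree : ∀ n₁ n₂ n₃ d i₁ i₂ k → sgn (i₁ ℕ.+ i₂) ≡ sgn (n₂ ℕ.+ n₃ ℕ.+ 1) →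
                        i₁ ℕ.+ suc k ≤ i₂ ℕ.+ d ℕ.+ n₂ → let a = matching-a i₁ i₂ n₂ n₃ in
                        ΔtopEntry n₁ n₂ n₃ a d i₁ (n₃ ℕ.+ suc k) ≡ ΔbottomEntry n₁ n₂ n₃ a d i₂ (n₃ ℕ.+ suc k)
  right-columns-agree n₁ n₂ n₃ d i₁ i₂ k parity room = begin
    ΔtopEntry n₁ n₂ n₃ a d i₁ j     ≡⟨ top-right-difference n₁ n₂ n₃ a d i₁ k ⟩
    σ * binom V p                   ≡⟨ binom-reflection M σ V p U q p+q≡M p-V-1≡M q-U-1≡M signs ⟩
    binom U q                       ≡⟨ bottom-right-difference n₁ n₂ n₃ a d i₂ k ⟨
    ΔbottomEntry n₁ n₂ n₃ a d i₂ j  ∎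
    where
    a = matching-a i₁ i₂ n₂ n₃
    j = n₃ ℕ.+ suc k
    σ = sgn (k ℕ.+ n₃) * sgn d
    V = + n₁ + + n₃ + a + + suc k - + 1 - + i₁ - + d
    p = + n₁ - + i₁
    U = - + n₁ + + n₂ + + n₃ + a - + 1 + + i₂
    q = - + n₁ + + n₂ - + suc k + + i₂ + + d

    -- M is a natural number by the hypothesis room; the three integer identities
    -- below are what binom-reflection needs.
    M = i₂ ℕ.+ d ℕ.+ n₂ ℕ.∸ (i₁ ℕ.+ suc k)
    M-int : + M ≡ + i₂ + + d + + n₂ - (+ i₁ + + suc k)
    M-int = begin
      + M                                     ≡⟨ ℤP.⊖-≥ room ⟨
      (i₂ ℕ.+ d ℕ.+ n₂) ℤ.⊖ (i₁ ℕ.+ suc k)    ≡⟨ ℤP.m-n≡m⊖n (i₂ ℕ.+ d ℕ.+ n₂) (i₁ ℕ.+ suc k) ⟨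
      + (i₂ ℕ.+ d ℕ.+ n₂) - + (i₁ ℕ.+ suc k)  ≡⟨ cong₂ _-_ i₂+d+n₂ (ℤP.pos-+ i₁ (suc k)) ⟩
      + i₂ + + d + + n₂ - (+ i₁ + + suc k)    ∎
      where
      i₂+d+n₂ : + (i₂ ℕ.+ d ℕ.+ n₂) ≡ + i₂ + + d + + n₂
      i₂+d+n₂ = trans (ℤP.pos-+ (i₂ ℕ.+ d) n₂) (cong (_+ + n₂) (ℤP.pos-+ i₂ d))

    sum : ∀ n₁ n₂ i₁ i₂ d s → (n₁ - i₁) + (- n₁ + n₂ - s + i₂ + d) ≡ i₂ + d + n₂ - (i₁ + s)
    sum = solve-∀
    p+q≡M : p + q ≡ + M
    p+q≡M = trans (sum (+ n₁) (+ n₂) (+ i₁) (+ i₂) (+ d) (+ suc k)) (sym M-int)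

    top-gap : ∀ n₁ n₂ n₃ i₁ i₂ d s →
              (n₁ - i₁) - ((n₁ + n₃ + (i₁ - i₂ - n₂ - n₃) + s - + 1) - i₁ - d) - + 1 ≡ i₂ + d + n₂ - (i₁ + s)
    top-gap = solve-∀
    p-V-1≡M : p - V - 1ℤ ≡ + M
    p-V-1≡M = trans (top-gap (+ n₁) (+ n₂) (+ n₃) (+ i₁) (+ i₂) (+ d) (+ suc k)) (sym M-int)

    bottom-gap : ∀ n₁ n₂ n₃ i₁ i₂ d s →
                 (- n₁ + n₂ - s + i₂ + d) - ((- n₁ + n₂ + n₃ + (i₁ - i₂ - n₂ - n₃) - + 1) + i₂) - + 1 ≡ i₂ + d + n₂ - (i₁ + s)
    bottom-gap = solve-∀
    q-U-1≡M : q - U - 1ℤ ≡ + M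
    q-U-1≡M = trans (bottom-gap (+ n₁) (+ n₂) (+ n₃) (+ i₁) (+ i₂) (+ d) (+ suc k)) (sym M-int)

    signs : σ * sgnℤ p ≡ sgnℤ q
    signs = right-column-signs n₁ n₂ n₃ d i₁ i₂ k parity

open Proof using (sgn-cong-mod-2; column-split; column-room; left-columns-agree; right-columns-agree)
open import Data.Nat using (ℕ; _+_; _≤_; _%_)
open import Data.Integer using (ℤ; +_; _-_)
open import Relation.Binary.PropositionalEquality using (_≡_; refl)
open import Data.Sum using (inj₁; inj₂)
open import Data.Product using (_,_)

lemma4 : (n₁ n₂ n₃ d i₁ i₂ : ℕ) → (a : ℤ) →
    n₃ ≤ n₁ + n₂ →
    a ≡ + i₁ - + i₂ - + n₂ - + n₃ →
    (i₁ + i₂) % 2 ≡ (n₂ + n₃ + 1) % 2 →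
    i₁ + n₁ ≤ i₂ + n₃ + d →
    1 ≤ i₁ → i₁ + d ≤ n₂ →
    1 ≤ i₂ → i₂ + d ≤ n₁ →
    (j : ℕ) → 1 ≤ j → j ≤ n₁ + n₂ →
    ΔtopEntry n₁ n₂ n₃ a d i₁ j ≡ ΔbottomEntry n₁ n₂ n₃ a d i₂ j
-- Only the parity condition, i₁ + n₁ ≤ i₂ + n₃ + d and j ≤ n₁ + n₂ enter the proof; the
-- remaining hypotheses merely keep the rows and columns inside the matrix.
lemma4 n₁ n₂ n₃ d i₁ i₂ a _ refl parity rows _ _ _ _ j _ j≤n₁+n₂ with column-split n₃ j
... | inj₁ j≤n₃ = left-columns-agree n₁ n₂ n₃ d i₁ i₂ j j≤n₃
... | inj₂ (k , refl) =
  right-columns-agree n₁ n₂ n₃ d i₁ i₂ k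
    (sgn-cong-mod-2 (i₁ + i₂) (n₂ + n₃ + 1) parity)
    (column-room n₁ n₂ n₃ d i₁ i₂ k rows j≤n₁+n₂)
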